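{- Let $n\ge 2$ be an integer, $p$ a prime, and put $e_p=\lfloor \log_p(n-1)\rfloor$. Let $r$ be an integer with $r\equiv 1\pmod p$, $r\ne -1$ and $r\neq 1$, and put $r_p=\nu_p(r-1)$. If $p=2$, assume in addition that $r$ is a perfect square. Then the integers $r,r^2,\ldots,r^n$ are pairwise incongruent modulo $p^{e_p+r_p+1}$.
   Context: For a prime $p$ and a nonzero integer $N$, $\nu_p(N)$ denotes the exponent of the highest power of $p$ dividing $N$. -}

module Defs where

open import Data.Nat using (ℕ; suc; _≤_; _<_; _^_)
open import Data.Integer using (ℤ; _-_; +_)
open import Data.Integer.Divisibility using (_∣_)
open import Data.Nat.Primality using (Prime)
open import Data.Product using (_×_)
open import Relation.Nullary using (¬_)

IsFloorLog : ℕ → ℕ → ℕ → Set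
IsFloorLog p m e = (p ^ e ≤ m) × (m < p ^ suc e)

IsValuation : ℕ → ℤ → ℕ → Set
IsValuation p N k = ((+ (p ^ k)) ∣ N) × ¬ ((+ (p ^ suc k)) ∣ N)

_≡_[mod_] : ℤ → ℤ → ℕ → Set
a ≡ b [mod m ] = (+ m) ∣ (a - b)

-- Write r = 1 + c with ν_p(c) = a, where a ≥ 1, and a ≥ 2 when p = 2 because an odd square is
-- 1 mod 4. The binomial expansion (1 + c)^k - 1 = k c + T_k c² + O(c³), T_k = k(k-1)/2, lifts
-- the exponent: ν_p((1 + c)^k - 1) = a when p ∤ k, and ν_p((1 + c)^p - 1) = a + 1. By induction on b,
-- p^(a+b+1) ∣ r^k - 1 forces p^(b+1) ∣ k. So if r^i ≡ r^j (mod p^(e+a+1)) with j < i, cancelling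
-- the unit r^j gives p^(e+1) ∣ i - j, impossible as 0 < i - j ≤ n - 1 < p^(e+1).
module Submission where

module LiftingTheExponent where

  open import Data.Nat as ℕ using (ℕ; zero; suc; s≤s; z≤n; NonZero)
  import Data.Nat.Properties as ℕ
  import Data.Nat.Divisibility as ℕ
  open import Data.Nat.Primality
    using (Prime; euclidsLemma; prime⇒nonZero; prime⇒nonTrivial; ¬prime[0]; ¬prime[1]; prime[2])
  open import Data.Integer using (ℤ; +_; _+_; _-_; _*_; _^_; 0ℤ; 1ℤ)
  open import Data.Integer.Properties
    using (pos-+; pos-*; abs-*; ∣i-j∣≡∣j-i∣; *-comm; *-identityʳ; *-assoc; ^-distribˡ-+-*; ^-*-assoc)
  import Data.Integer as ℤ using (NonZero; ∣_∣)
  open import Data.Integer.Divisibility.Signed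
  open import Data.Integer.Tactic.RingSolver using (solve-∀)
  open import Data.Nat.Tactic.RingSolver using () renaming (solve-∀ to ℕ-solve-∀)
  open import Data.Product using (∃; _×_; _,_; proj₁)
  open import Data.Sum using (_⊎_; inj₁; inj₂; [_,_]′)
  import Data.Sum as Sum
  open import Function using (_∘_; id)
  open import Relation.Nullary using (¬_; yes; no; contradiction)
  open import Relation.Binary.PropositionalEquality
    using (_≡_; _≢_; refl; sym; trans; cong; cong₂; subst; subst₂; module ≡-Reasoning)
  open import Defs using (IsValuation; _≡_[mod_])

  variable
    p a k m : ℕ
    c r x y : ℤ

  pos-^ : ∀ m n → + (m ℕ.^ n) ≡ (+ m) ^ n
  pos-^ m zero = refl
  pos-^ m (suc n) = trans (pos-* m (m ℕ.^ n)) (cong (+ m *_) (pos-^ m n))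

  ^-nonZero : ∀ m n .{{_ : NonZero m}} → ℤ.NonZero ((+ m) ^ n)
  ^-nonZero m n = subst ℤ.NonZero (pos-^ m n) (ℕ.m^n≢0 m n)

  ^-monoʳ-∣ : ∀ i → m ℕ.≤ k → i ^ m ∣ i ^ k
  ^-monoʳ-∣ {m = m} {k = k} i m≤k = divides (i ^ (k ℕ.∸ m)) (begin
    i ^ k                   ≡⟨ cong (i ^_) (sym (ℕ.m+[n∸m]≡n m≤k)) ⟩
    i ^ (m ℕ.+ (k ℕ.∸ m))   ≡⟨ ^-distribˡ-+-* i m (k ℕ.∸ m) ⟩
    i ^ m * i ^ (k ℕ.∸ m)   ≡⟨ *-comm (i ^ m) _ ⟩
    i ^ (k ℕ.∸ m) * i ^ m   ∎)
    where open ≡-Reasoning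

  *-pres-∣ : ∀ {i j} → i ∣ x → j ∣ y → i * j ∣ x * y
  *-pres-∣ {x = x} {y = y} {i} {j} i∣x j∣y = ∣ᵤ⇒∣ (subst₂ ℕ._∣_ (sym (abs-* i j)) (sym (abs-* x y))
    (ℕ.*-pres-∣ (∣⇒∣ᵤ i∣x) (∣⇒∣ᵤ j∣y)))

  *-pres-^∣ : ∀ i m n → i ^ m ∣ x → i ^ n ∣ y → i ^ (m ℕ.+ n) ∣ x * y
  *-pres-^∣ {x = x} {y = y} i m n d e = subst (_∣ x * y) (sym (^-distribˡ-+-* i m n)) (*-pres-∣ d e)

  prime∣*⇒∣⊎∣ : Prime p → + p ∣ x * y → + p ∣ x ⊎ + p ∣ y
  prime∣*⇒∣⊎∣ {x = x} {y = y} pp d =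
    Sum.map ∣ᵤ⇒∣ ∣ᵤ⇒∣ (euclidsLemma ℤ.∣ x ∣ ℤ.∣ y ∣ pp (subst (_ ℕ.∣_) (abs-* x y) (∣⇒∣ᵤ d)))

  prime∤1 : Prime p → ¬ (+ p ∣ 1ℤ)
  prime∤1 pp d = ¬prime[1] (subst Prime (ℕ.∣1⇒≡1 (∣⇒∣ᵤ d)) pp)

  prime∣x⇒prime∤1+x : Prime p → + p ∣ x → ¬ (+ p ∣ 1ℤ + x)
  prime∣x⇒prime∤1+x pp p∣x p∣1+x = prime∤1 pp (∣m+n∣n⇒∣m p∣1+x p∣x)

  prime∤x⇒prime∤x^n : Prime p → ¬ (+ p ∣ x) → ∀ n → ¬ (+ p ∣ x ^ n)
  prime∤x⇒prime∤x^n pp p∤x zero = prime∤1 pp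
  prime∤x⇒prime∤x^n pp p∤x (suc n) d =
    [ p∤x , prime∤x⇒prime∤x^n pp p∤x n ]′ (prime∣*⇒∣⊎∣ pp d)

  prime-power-divisor : Prime p → ¬ (+ p ∣ x) → ∀ k → (+ p) ^ k ∣ x * y → (+ p) ^ k ∣ y
  prime-power-divisor pp p∤x zero _ = ∣ᵤ⇒∣ (ℕ.1∣ _)
  prime-power-divisor {p} {x} pp p∤x (suc k) d
    with prime∣*⇒∣⊎∣ pp (∣-trans (∣m⇒∣m*n ((+ p) ^ k) ∣-refl) d)
  ... | inj₁ p∣x = contradiction p∣x p∤x
  ... | inj₂ (divides q refl) =
    subst ((+ p) ^ suc k ∣_) (*-comm (+ p) q) (*-monoʳ-∣ (+ p) (prime-power-divisor pp p∤x k p^k∣x*q))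
    where
    instance _ = prime⇒nonZero pp
    p^k∣x*q : (+ p) ^ k ∣ x * q
    p^k∣x*q = *-cancelˡ-∣ (+ p) (subst ((+ p) ^ suc k ∣_) (x*[q*p]≡p*[x*q] x q (+ p)) d)
      where
      x*[q*p]≡p*[x*q] : ∀ x q p → x * (q * p) ≡ p * (x * q)
      x*[q*p]≡p*[x*q] = solve-∀

  prime∣2⇒≡2 : Prime p → p ℕ.∣ 2 → p ≡ 2
  prime∣2⇒≡2 {p} pp p∣2 = ℕ.≤-antisym (ℕ.∣⇒≤ p∣2) (ℕ.nonTrivial⇒n>1 p)
    where instance _ = prime⇒nonTrivial pp

  square∧2∣r-1⇒4∣r-1 : (∃ λ s → r ≡ s * s) → + 2 ∣ r - 1ℤ → + 4 ∣ r - 1ℤ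
  square∧2∣r-1⇒4∣r-1 (s , refl) 2∣s*s-1 =
    subst (+ 4 ∣_) (sym (s*s-1≡[s-1]*[s+1] s)) (*-pres-∣ 2∣s-1 2∣s+1)
    where
    s*s-1≡[s-1]*[s+1] : ∀ s → s * s - 1ℤ ≡ (s - 1ℤ) * (s + 1ℤ)
    s*s-1≡[s-1]*[s+1] = solve-∀
    [s-1]+2≡s+1 : ∀ s → (s - 1ℤ) + + 2 ≡ s + 1ℤ
    [s-1]+2≡s+1 = solve-∀
    [s+1]-2≡s-1 : ∀ s → (s + 1ℤ) - + 2 ≡ s - 1ℤ
    [s+1]-2≡s-1 = solve-∀
    2∣s-1⊎2∣s+1 : + 2 ∣ s - 1ℤ ⊎ + 2 ∣ s + 1ℤ
    2∣s-1⊎2∣s+1 = prime∣*⇒∣⊎∣ prime[2] (subst (+ 2 ∣_) (s*s-1≡[s-1]*[s+1] s) 2∣s*s-1)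
    2∣s-1 : + 2 ∣ s - 1ℤ
    2∣s-1 = [ id , (λ 2∣s+1 → subst (+ 2 ∣_) ([s+1]-2≡s-1 s) (∣m∣n⇒∣m-n 2∣s+1 ∣-refl)) ]′
              2∣s-1⊎2∣s+1
    2∣s+1 : + 2 ∣ s + 1ℤ
    2∣s+1 = subst (+ 2 ∣_) ([s-1]+2≡s+1 s) (∣m∣n⇒∣m+n 2∣s-1 ∣-refl)

  triangular : ℕ → ℕ
  triangular zero = zero
  triangular (suc n) = triangular n ℕ.+ n

  2*triangular[1+n]≡[1+n]*n : ∀ n → 2 ℕ.* triangular (suc n) ≡ suc n ℕ.* n
  2*triangular[1+n]≡[1+n]*n zero = refl
  2*triangular[1+n]≡[1+n]*n (suc n) = begin
    2 ℕ.* (triangular (suc n) ℕ.+ suc n)         ≡⟨ ℕ.*-distribˡ-+ 2 (triangular (suc n)) (suc n) ⟩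
    2 ℕ.* triangular (suc n) ℕ.+ 2 ℕ.* suc n     ≡⟨ cong (ℕ._+ 2 ℕ.* suc n) (2*triangular[1+n]≡[1+n]*n n) ⟩
    suc n ℕ.* n ℕ.+ 2 ℕ.* suc n                  ≡⟨ regroup n ⟩
    suc (suc n) ℕ.* suc n                        ∎
    where
    open ≡-Reasoning
    regroup : ∀ n → suc n ℕ.* n ℕ.+ 2 ℕ.* suc n ≡ suc (suc n) ℕ.* suc n
    regroup = ℕ-solve-∀

  prime∣triangular : Prime p → p ≢ 2 → p ℕ.∣ triangular p
  prime∣triangular {zero} pp _ = contradiction pp ¬prime[0]
  prime∣triangular {suc n} pp p≢2 =
    [ (λ p∣2 → contradiction (prime∣2⇒≡2 pp p∣2) p≢2) , id ]′
      (euclidsLemma 2 (triangular (suc n)) pp (ℕ.divides n 2*T≡n*p))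
    where
    2*T≡n*p : 2 ℕ.* triangular (suc n) ≡ n ℕ.* suc n
    2*T≡n*p = trans (2*triangular[1+n]≡[1+n]*n n) (ℕ.*-comm (suc n) n)

  binomial-expansion : ∀ c k → ∃ λ X →
    (1ℤ + c) ^ k - 1ℤ ≡ + k * c + (+ triangular k * (c * c) + X * (c * (c * c)))
  binomial-expansion c zero = 0ℤ , 1-1≡0 c
    where
    1-1≡0 : ∀ c → 1ℤ - 1ℤ ≡ 0ℤ * c + (0ℤ * (c * c) + 0ℤ * (c * (c * c)))
    1-1≡0 = solve-∀
  binomial-expansion c (suc k) with binomial-expansion c k
  ... | X , eq = X + T + X * c , (begin
    (1ℤ + c) * (1ℤ + c) ^ k - 1ℤ
      ≡⟨ [1+c]*y-1≡c+[y-1]+c*[y-1] c ((1ℤ + c) ^ k) ⟩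
    c + ((1ℤ + c) ^ k - 1ℤ) + c * ((1ℤ + c) ^ k - 1ℤ)
      ≡⟨ cong (λ E → c + E + c * E) eq ⟩
    c + E + c * E
      ≡⟨ collect c (+ k) T X ⟩
    (1ℤ + + k) * c + ((T + + k) * (c * c) + (X + T + X * c) * (c * (c * c)))
      ≡⟨ cong₂ (λ K T′ → K * c + (T′ * (c * c) + (X + T + X * c) * (c * (c * c))))
           (sym (pos-+ 1 k)) (sym (pos-+ (triangular k) k)) ⟩
    + suc k * c + (+ triangular (suc k) * (c * c) + (X + T + X * c) * (c * (c * c))) ∎)
    where
    open ≡-Reasoning
    T = + triangular k
    E = + k * c + (T * (c * c) + X * (c * (c * c)))
    [1+c]*y-1≡c+[y-1]+c*[y-1] : ∀ c y → (1ℤ + c) * y - 1ℤ ≡ c + (y - 1ℤ) + c * (y - 1ℤ)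
    [1+c]*y-1≡c+[y-1]+c*[y-1] = solve-∀
    collect : ∀ c K T X →
      c + (K * c + (T * (c * c) + X * (c * (c * c)))) + c * (K * c + (T * (c * c) + X * (c * (c * c))))
        ≡ (1ℤ + K) * c + ((T + K) * (c * c) + (X + T + X * c) * (c * (c * c)))
    collect = solve-∀

  record ExactPower (p a : ℕ) (c : ℤ) : Set where
    constructor exactPower
    field
      unit       : ℤ
      c≡unit*p^a : c ≡ unit * (+ p) ^ a
      p∤unit     : ¬ (+ p ∣ unit)

  exactPower⇒∣ : ExactPower p a c → (+ p) ^ a ∣ c
  exactPower⇒∣ (exactPower u c≡u*p^a _) = divides u c≡u*p^a

  exactPower⇒∤ : Prime p → ExactPower p a c → ¬ ((+ p) ^ suc a ∣ c)
  exactPower⇒∤ {p} {a} pp (exactPower u refl p∤u) p^[1+a]∣c =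
    p∤u (*-cancelʳ-∣ ((+ p) ^ a) p^[1+a]∣c)
    where instance
      _ = prime⇒nonZero pp
      _ = ^-nonZero p a

  exactPower-+ : ExactPower p a c → (+ p) ^ suc a ∣ x → ExactPower p a (c + x)
  exactPower-+ {p} {a} (exactPower u refl p∤u) (divides w refl) =
    exactPower (u + w * + p) (regroup u w (+ p) ((+ p) ^ a))
      λ p∣u+w*p → p∤u (∣m+n∣n⇒∣m p∣u+w*p (∣n⇒∣m*n w ∣-refl))
    where
    regroup : ∀ u w P Q → u * Q + w * (P * Q) ≡ (u + w * P) * Q
    regroup = solve-∀

  exactPower-p* : ExactPower p a c → ExactPower p (suc a) (+ p * c)
  exactPower-p* {p} {a} (exactPower u refl p∤u) = exactPower u (regroup (+ p) u ((+ p) ^ a)) p∤u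
    where
    regroup : ∀ P u Q → P * (u * Q) ≡ u * (P * Q)
    regroup = solve-∀

  exactPower-* : Prime p → ¬ (+ p ∣ x) → ExactPower p a c → ExactPower p a (x * c)
  exactPower-* {x = x} pp p∤x (exactPower u refl p∤u) =
    exactPower (x * u) (sym (*-assoc x u _)) ([ p∤x , p∤u ]′ ∘ prime∣*⇒∣⊎∣ pp)

  Liftable : ℕ → ℕ → Set
  Liftable p a = 1 ℕ.≤ a × (p ≡ 2 → 2 ℕ.≤ a)

  liftable-suc : Liftable p a → Liftable p (suc a)
  liftable-suc (1≤a , _) = s≤s z≤n , λ _ → s≤s 1≤a

  exactPower-[1+c]^k-1 : Prime p → 1 ℕ.≤ a → ExactPower p a c → ¬ (+ p ∣ + k) →
                         ExactPower p a ((1ℤ + c) ^ k - 1ℤ)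
  exactPower-[1+c]^k-1 {p} {a} {c} {k} pp 1≤a ex p∤k with binomial-expansion c k
  ... | X , eq = subst (ExactPower p a) (sym eq) (exactPower-+ (exactPower-* pp p∤k ex) p^[1+a]∣tail)
    where
    p^[1+a]∣c*c : (+ p) ^ suc a ∣ c * c
    p^[1+a]∣c*c = ∣-trans (^-monoʳ-∣ (+ p) (ℕ.+-monoˡ-≤ a 1≤a))
                          (*-pres-^∣ (+ p) a a (exactPower⇒∣ ex) (exactPower⇒∣ ex))
    p^[1+a]∣tail : (+ p) ^ suc a ∣ + triangular k * (c * c) + X * (c * (c * c))
    p^[1+a]∣tail =
      ∣m∣n⇒∣m+n (∣n⇒∣m*n (+ triangular k) p^[1+a]∣c*c) (∣n⇒∣m*n X (∣n⇒∣m*n c p^[1+a]∣c*c))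

  exactPower-[1+c]^p-1 : Prime p → Liftable p a → ExactPower p a c →
                         ExactPower p (suc a) ((1ℤ + c) ^ p - 1ℤ)
  exactPower-[1+c]^p-1 {p} {a} {c} pp (1≤a , 2≤a) ex with binomial-expansion c p
  ... | X , eq = subst (ExactPower p (suc a)) (sym eq) (exactPower-+ (exactPower-p* ex) (∣m∣n⇒∣m+n quadratic cubic))
    where
    p^a∣c : (+ p) ^ a ∣ c
    p^a∣c = exactPower⇒∣ ex
    p^[a+a]∣c*c : (+ p) ^ (a ℕ.+ a) ∣ c * c
    p^[a+a]∣c*c = *-pres-^∣ (+ p) a a p^a∣c p^a∣c
    -- For p = 2 the coefficient T₂ = 1 is a unit; this is where a ≥ 2 is needed.
    quadratic : (+ p) ^ suc (suc a) ∣ + triangular p * (c * c)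
    quadratic with p ℕ.≟ 2
    ... | yes p≡2 = ∣n⇒∣m*n (+ triangular p) (∣-trans (^-monoʳ-∣ (+ p) (ℕ.+-monoˡ-≤ a (2≤a p≡2))) p^[a+a]∣c*c)
    ... | no p≢2 = ∣-trans (^-monoʳ-∣ (+ p) (s≤s (ℕ.+-monoˡ-≤ a 1≤a)))
                     (*-pres-∣ (∣ᵤ⇒∣ {+ p} {+ triangular p} (prime∣triangular pp p≢2)) p^[a+a]∣c*c)
    cubic : (+ p) ^ suc (suc a) ∣ X * (c * (c * c))
    cubic = ∣n⇒∣m*n X (∣-trans (^-monoʳ-∣ (+ p) (ℕ.+-mono-≤ 1≤a (ℕ.+-monoˡ-≤ a 1≤a)))
                                (*-pres-^∣ (+ p) a (a ℕ.+ a) p^a∣c p^[a+a]∣c*c))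

  p^[1+a]∣[1+c]^k-1⇒p∣k : Prime p → 1 ℕ.≤ a → ExactPower p a c →
                          (+ p) ^ suc a ∣ (1ℤ + c) ^ k - 1ℤ → p ℕ.∣ k
  p^[1+a]∣[1+c]^k-1⇒p∣k {p} {k = k} pp 1≤a ex p^[1+a]∣[1+c]^k-1 with p ℕ.∣? k
  ... | yes p∣k = p∣k
  ... | no p∤k =
    contradiction p^[1+a]∣[1+c]^k-1 (exactPower⇒∤ pp (exactPower-[1+c]^k-1 pp 1≤a ex (p∤k ∘ ∣⇒∣ᵤ)))

  p^[1+b+a]∣[1+c]^k-1⇒p^[1+b]∣k : Prime p → Liftable p a → ExactPower p a c → ∀ b k →
                                  (+ p) ^ (suc b ℕ.+ a) ∣ (1ℤ + c) ^ k - 1ℤ → p ℕ.^ suc b ℕ.∣ k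
  p^[1+b+a]∣[1+c]^k-1⇒p^[1+b]∣k {p} pp lift ex zero k d =
    subst (ℕ._∣ k) (sym (ℕ.*-identityʳ p)) (p^[1+a]∣[1+c]^k-1⇒p∣k pp (proj₁ lift) ex d)
  p^[1+b+a]∣[1+c]^k-1⇒p^[1+b]∣k {p} {a} {c} pp lift ex (suc b) k d
    with p^[1+a]∣[1+c]^k-1⇒p∣k {k = k} pp (proj₁ lift) ex
           (∣-trans (^-monoʳ-∣ (+ p) (s≤s (ℕ.m≤n+m a (suc b)))) d)
  ... | ℕ.divides m refl = subst (p ℕ.^ suc (suc b) ℕ.∣_) (ℕ.*-comm p m) (ℕ.*-monoʳ-∣ p p^[1+b]∣m)
    where
    c′ : ℤ
    c′ = (1ℤ + c) ^ p - 1ℤ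
    [1+c′]^m≡[1+c]^[m*p] : (1ℤ + c′) ^ m ≡ (1ℤ + c) ^ (m ℕ.* p)
    [1+c′]^m≡[1+c]^[m*p] = begin
      (1ℤ + c′) ^ m           ≡⟨ cong (_^ m) (1+[y-1]≡y ((1ℤ + c) ^ p)) ⟩
      ((1ℤ + c) ^ p) ^ m      ≡⟨ ^-*-assoc (1ℤ + c) p m ⟩
      (1ℤ + c) ^ (p ℕ.* m)    ≡⟨ cong ((1ℤ + c) ^_) (ℕ.*-comm p m) ⟩
      (1ℤ + c) ^ (m ℕ.* p)    ∎
      where
      open ≡-Reasoning
      1+[y-1]≡y : ∀ y → 1ℤ + (y - 1ℤ) ≡ y
      1+[y-1]≡y = solve-∀
    p^[1+b]∣m : p ℕ.^ suc b ℕ.∣ m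
    p^[1+b]∣m = p^[1+b+a]∣[1+c]^k-1⇒p^[1+b]∣k pp (liftable-suc lift) (exactPower-[1+c]^p-1 pp lift ex) b m
      (subst₂ (λ e z → (+ p) ^ e ∣ z - 1ℤ) (sym (ℕ.+-suc (suc b) a)) (sym [1+c′]^m≡[1+c]^[m*p]) d)

  isValuation⇒exactPower : IsValuation p c a → ExactPower p a c
  isValuation⇒exactPower {p = p} {c = c} {a = a} (p^a∣c , p^[1+a]∤c) with ∣ᵤ⇒∣ {+ (p ℕ.^ a)} {c} p^a∣c
  ... | divides u c≡u*p^a = exactPower u (trans c≡u*p^a (cong (u *_) (pos-^ p a))) p∤u
    where
    p∤u : ¬ (+ p ∣ u)
    p∤u (divides v u≡v*p) = p^[1+a]∤c (∣⇒∣ᵤ (divides v (begin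
      c                          ≡⟨ c≡u*p^a ⟩
      u * + (p ℕ.^ a)            ≡⟨ cong (_* + (p ℕ.^ a)) u≡v*p ⟩
      v * + p * + (p ℕ.^ a)      ≡⟨ *-assoc v (+ p) _ ⟩
      v * (+ p * + (p ℕ.^ a))    ≡⟨ cong (v *_) (pos-* p (p ℕ.^ a)) ⟨
      v * + (p ℕ.^ suc a)        ∎)))
      where open ≡-Reasoning

  liftable : Prime p → + p ∣ r - 1ℤ → ExactPower p a (r - 1ℤ) →
             (p ≡ 2 → ∃ λ s → r ≡ s * s) → Liftable p a
  liftable {p} {a = zero} pp p∣r-1 ex _ =
    contradiction (subst (_∣ _) (sym (*-identityʳ (+ p))) p∣r-1) (exactPower⇒∤ pp ex)
  liftable {a = suc zero} pp p∣r-1 ex square =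
    s≤s z≤n , λ { refl → contradiction (square∧2∣r-1⇒4∣r-1 (square refl) p∣r-1) (exactPower⇒∤ pp ex) }
  liftable {a = suc (suc a)} _ _ _ _ = s≤s z≤n , λ _ → s≤s (s≤s z≤n)

  ≡[mod]-sym : x ≡ y [mod m ] → y ≡ x [mod m ]
  ≡[mod]-sym {x = x} {y = y} = subst (_ ℕ.∣_) (∣i-j∣≡∣j-i∣ x y)

  r^i≡r^j⇒p^[1+e]∣i∸j : Prime p → Liftable p a → + p ∣ r - 1ℤ → ExactPower p a (r - 1ℤ) →
                        ∀ e {i j : ℕ} → j ℕ.≤ i → (r ^ i) ≡ (r ^ j) [mod p ℕ.^ (e ℕ.+ a ℕ.+ 1) ] →
                        p ℕ.^ suc e ℕ.∣ i ℕ.∸ j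
  r^i≡r^j⇒p^[1+e]∣i∸j {p} {a} {r} pp lift p∣r-1 ex e {i} {j} j≤i r^i≡r^j =
    p^[1+b+a]∣[1+c]^k-1⇒p^[1+b]∣k pp lift ex e (i ℕ.∸ j)
      (subst (λ z → (+ p) ^ (suc e ℕ.+ a) ∣ z ^ (i ℕ.∸ j) - 1ℤ) (sym (1+[r-1]≡r r)) p^[1+e+a]∣r^[i-j]-1)
    where
    1+[r-1]≡r : ∀ r → 1ℤ + (r - 1ℤ) ≡ r
    1+[r-1]≡r = solve-∀
    p∤r : ¬ (+ p ∣ r)
    p∤r = subst (λ z → ¬ (+ p ∣ z)) (1+[r-1]≡r r) (prime∣x⇒prime∤1+x pp p∣r-1)
    r^i-r^j≡r^j*[r^[i-j]-1] : r ^ i - r ^ j ≡ r ^ j * (r ^ (i ℕ.∸ j) - 1ℤ)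
    r^i-r^j≡r^j*[r^[i-j]-1] = begin
      r ^ i - r ^ j                          ≡⟨ cong (λ n → r ^ n - r ^ j) (ℕ.m+[n∸m]≡n j≤i) ⟨
      r ^ (j ℕ.+ (i ℕ.∸ j)) - r ^ j          ≡⟨ cong (_- r ^ j) (^-distribˡ-+-* r j (i ℕ.∸ j)) ⟩
      r ^ j * r ^ (i ℕ.∸ j) - r ^ j          ≡⟨ x*y-x≡x*[y-1] (r ^ j) (r ^ (i ℕ.∸ j)) ⟩
      r ^ j * (r ^ (i ℕ.∸ j) - 1ℤ)           ∎
      where
      open ≡-Reasoning
      x*y-x≡x*[y-1] : ∀ x y → x * y - x ≡ x * (y - 1ℤ)
      x*y-x≡x*[y-1] = solve-∀
    p^[1+e+a]∣r^i-r^j : (+ p) ^ (suc e ℕ.+ a) ∣ r ^ i - r ^ j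
    p^[1+e+a]∣r^i-r^j = subst (_∣ r ^ i - r ^ j)
      (trans (pos-^ p (e ℕ.+ a ℕ.+ 1)) (cong ((+ p) ^_) (ℕ.+-comm (e ℕ.+ a) 1))) (∣ᵤ⇒∣ r^i≡r^j)
    p^[1+e+a]∣r^[i-j]-1 : (+ p) ^ (suc e ℕ.+ a) ∣ r ^ (i ℕ.∸ j) - 1ℤ
    p^[1+e+a]∣r^[i-j]-1 = prime-power-divisor pp (prime∤x⇒prime∤x^n pp p∤r j) (suc e ℕ.+ a)
      (subst (_ ∣_) r^i-r^j≡r^j*[r^[i-j]-1] p^[1+e+a]∣r^i-r^j)

open import Defs
open import Data.Nat using (ℕ; _≤_; _+_; _∸_; _^_)
open import Data.Integer using (ℤ; _*_; -_; +_; _-_)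
open import Data.Integer using () renaming (_^_ to _^ℤ_)
open import Data.Nat.Primality using (Prime)
open import Data.Product using (Σ)
open import Relation.Binary.PropositionalEquality using (_≡_; _≢_)
open import Relation.Nullary using (¬_)
import Data.Nat as ℕ
import Data.Nat.Properties as ℕ
import Data.Nat.Divisibility as ℕ
open import Data.Product using (_,_)
open import Data.Sum using ([_,_]′)
open import Function using (_∘_)
open import Relation.Binary.PropositionalEquality using (sym)
open import Data.Integer.Divisibility.Signed using (_∣_; ∣ᵤ⇒∣)
open LiftingTheExponent
  using (ExactPower; Liftable; liftable; isValuation⇒exactPower; ≡[mod]-sym; r^i≡r^j⇒p^[1+e]∣i∸j)

proposition2 : (n p : ℕ) → 2 ≤ n → Prime p →
    (e : ℕ) → IsFloorLog p (n ∸ 1) e →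
    (r : ℤ) → r ≡ + 1 [mod p ] → r ≢ - (+ 1) → r ≢ + 1 →
    (rp : ℕ) → IsValuation p (r - + 1) rp →
    (p ≡ 2 → Σ ℤ (λ s → r ≡ s * s)) →
    (i j : ℕ) → 1 ≤ i → i ≤ n → 1 ≤ j → j ≤ n → i ≢ j →
    ¬ ((r ^ℤ i) ≡ (r ^ℤ j) [mod (p ^ (e + rp + 1)) ])
proposition2 n p _ pp e (_ , n∸1<p^[1+e]) r r≡1 _ _ rp valuation square i j 1≤i i≤n 1≤j j≤n i≢j r^i≡r^j =
  [ (λ j≤i → incongruent 1≤j i≤n (ℕ.≤∧≢⇒< j≤i (i≢j ∘ sym)) r^i≡r^j)
  , (λ i≤j → incongruent 1≤i j≤n (ℕ.≤∧≢⇒< i≤j i≢j) (≡[mod]-sym {x = r ^ℤ i} {y = r ^ℤ j} r^i≡r^j))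
  ]′ (ℕ.≤-total j i)
  where
  p∣r-1 : + p ∣ r - + 1
  p∣r-1 = ∣ᵤ⇒∣ r≡1
  ex : ExactPower p rp (r - + 1)
  ex = isValuation⇒exactPower valuation
  lift : Liftable p rp
  lift = liftable pp p∣r-1 ex square
  incongruent : ∀ {k l} → 1 ≤ l → k ≤ n → l ℕ.< k → ¬ ((r ^ℤ k) ≡ (r ^ℤ l) [mod (p ^ (e + rp + 1)) ])
  incongruent 1≤l k≤n l<k r^k≡r^l =
    ℕ.<⇒≱ (ℕ.≤-<-trans (ℕ.∸-mono k≤n 1≤l) n∸1<p^[1+e])
          (ℕ.∣⇒≤ (r^i≡r^j⇒p^[1+e]∣i∸j pp lift p∣r-1 ex e (ℕ.<⇒≤ l<k) r^k≡r^l))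
    where instance _ = ℕ.>-nonZero (ℕ.m<n⇒0<n∸m l<k)
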